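{- Let $F$ be a formula with $\mathsf{CL} \vdash \neg F$ but $\mathsf{IL} \nvdash \neg F$, and define for every formula $A$: $N_1(A) :\equiv A^G \vee F$ and $N_2(A) :\equiv A^G[F/\bot]$. Then $N_1$ and $N_2$ are not equivalent in $\mathsf{IL}$, i.e. there is a formula $A$ with $\mathsf{IL} \nvdash N_1(A) \leftrightarrow N_2(A)$.
   Context: $\mathsf{CL}$ is pure first-order classical predicate logic based on $\bot, \wedge, \vee, \to, \forall, \exists$ (with $\neg A :\equiv A\to\bot$); $\mathsf{IL}$ is its intuitionistic counterpart. $A^G$ is the Gödel–Gentzen translation: $P^G :\equiv \neg\neg P$ for atomic $P \not\equiv \bot$; $\bot^G :\equiv \bot$; $(A\wedge B)^G :\equiv A^G\wedge B^G$; $(A\vee B)^G :\equiv \neg(\neg A^G\wedge\neg B^G)$; $(A\to B)^G :\equiv A^G\to B^G$; $(\forall xA)^G :\equiv \forall x A^G$; $(\exists xA)^G :\equiv \neg\forall x\neg A^G$. $A^G[F/\bot]$ denotes the result of replacing every occurrence of $\bot$ in $A^G$ by $F$. -}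

module Defs where

open import Data.Nat using (ℕ; zero; suc)
open import Data.Vec using (Vec)
import Data.Vec as Vec
open import Data.List using (List; []; _∷_; map)
open import Data.List.Membership.Propositional using (_∈_)

-- Pure first-order predicate logic: no function symbols, terms are variables
-- (de Bruijn indices). Countably many predicate symbols of every arity:
-- atom p n xs is the p-th predicate symbol of arity n applied to variables xs.

data Fm : Set where
  atom : (p n : ℕ) → Vec ℕ n → Fm
  ⊥'   : Fm
  _∧'_ : Fm → Fm → Fm
  _∨'_ : Fm → Fm → Fm
  _⇒_  : Fm → Fm → Fm
  ∀'   : Fm → Fm
  ∃'   : Fm → Fm

infixr 6 _∧'_
infixr 5 _∨'_
infixr 4 _⇒_

¬' : Fm → Fm
¬' A = A ⇒ ⊥'

_⇔_ : Fm → Fm → Fm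
A ⇔ B = (A ⇒ B) ∧' (B ⇒ A)

lift : (ℕ → ℕ) → ℕ → ℕ
lift ρ zero = zero
lift ρ (suc n) = suc (ρ n)

ren : (ℕ → ℕ) → Fm → Fm
ren ρ (atom p n xs) = atom p n (Vec.map ρ xs)
ren ρ ⊥' = ⊥'
ren ρ (A ∧' B) = ren ρ A ∧' ren ρ B
ren ρ (A ∨' B) = ren ρ A ∨' ren ρ B
ren ρ (A ⇒ B) = ren ρ A ⇒ ren ρ B
ren ρ (∀' A) = ∀' (ren (lift ρ) A)
ren ρ (∃' A) = ∃' (ren (lift ρ) A)

shift : Fm → Fm
shift = ren suc

inst0 : ℕ → ℕ → ℕ
inst0 x zero = x
inst0 x (suc n) = n

_[_] : Fm → ℕ → Fm
A [ x ] = ren (inst0 x) A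

data Logic : Set where
  IL CL : Logic

data _⨾_⊢_ : Logic → List Fm → Fm → Set where
  hyp  : ∀ {L Γ A} → A ∈ Γ → L ⨾ Γ ⊢ A
  ⊥E   : ∀ {L Γ A} → L ⨾ Γ ⊢ ⊥' → L ⨾ Γ ⊢ A
  raa  : ∀ {Γ A} → CL ⨾ (¬' A ∷ Γ) ⊢ ⊥' → CL ⨾ Γ ⊢ A
  ∧I   : ∀ {L Γ A B} → L ⨾ Γ ⊢ A → L ⨾ Γ ⊢ B → L ⨾ Γ ⊢ (A ∧' B)
  ∧E₁  : ∀ {L Γ A B} → L ⨾ Γ ⊢ (A ∧' B) → L ⨾ Γ ⊢ A
  ∧E₂  : ∀ {L Γ A B} → L ⨾ Γ ⊢ (A ∧' B) → L ⨾ Γ ⊢ B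
  ∨I₁  : ∀ {L Γ A B} → L ⨾ Γ ⊢ A → L ⨾ Γ ⊢ (A ∨' B)
  ∨I₂  : ∀ {L Γ A B} → L ⨾ Γ ⊢ B → L ⨾ Γ ⊢ (A ∨' B)
  ∨E   : ∀ {L Γ A B C} → L ⨾ Γ ⊢ (A ∨' B) → L ⨾ (A ∷ Γ) ⊢ C → L ⨾ (B ∷ Γ) ⊢ C
         → L ⨾ Γ ⊢ C
  ⇒I   : ∀ {L Γ A B} → L ⨾ (A ∷ Γ) ⊢ B → L ⨾ Γ ⊢ (A ⇒ B)
  ⇒E   : ∀ {L Γ A B} → L ⨾ Γ ⊢ (A ⇒ B) → L ⨾ Γ ⊢ A → L ⨾ Γ ⊢ B
  ∀I   : ∀ {L Γ A} → L ⨾ map shift Γ ⊢ A → L ⨾ Γ ⊢ ∀' A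
  ∀E   : ∀ {L Γ A} (x : ℕ) → L ⨾ Γ ⊢ ∀' A → L ⨾ Γ ⊢ (A [ x ])
  ∃I   : ∀ {L Γ A} (x : ℕ) → L ⨾ Γ ⊢ (A [ x ]) → L ⨾ Γ ⊢ ∃' A
  ∃E   : ∀ {L Γ A B} → L ⨾ Γ ⊢ ∃' A → L ⨾ (A ∷ map shift Γ) ⊢ shift B
         → L ⨾ Γ ⊢ B

_⊢_ : Logic → Fm → Set
L ⊢ A = L ⨾ [] ⊢ A

_ᴳ : Fm → Fm
atom p n xs ᴳ = ¬' (¬' (atom p n xs))
⊥' ᴳ = ⊥'
(A ∧' B) ᴳ = (A ᴳ) ∧' (B ᴳ)
(A ∨' B) ᴳ = ¬' (¬' (A ᴳ) ∧' ¬' (B ᴳ))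
(A ⇒ B) ᴳ = (A ᴳ) ⇒ (B ᴳ)
∀' A ᴳ = ∀' (A ᴳ)
∃' A ᴳ = ¬' (∀' (¬' (A ᴳ)))

_[_/⊥] : Fm → Fm → Fm
atom p n xs [ F /⊥] = atom p n xs
⊥' [ F /⊥] = F
(A ∧' B) [ F /⊥] = (A [ F /⊥]) ∧' (B [ F /⊥])
(A ∨' B) [ F /⊥] = (A [ F /⊥]) ∨' (B [ F /⊥])
(A ⇒ B) [ F /⊥] = (A [ F /⊥]) ⇒ (B [ F /⊥])
∀' A [ F /⊥] = ∀' (A [ shift F /⊥])
∃' A [ F /⊥] = ∃' (A [ shift F /⊥])

N₁ : Fm → Fm → Fm
N₁ F A = (A ᴳ) ∨' F

N₂ : Fm → Fm → Fm
N₂ F A = (A ᴳ) [ F /⊥]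

-- Take A := ¬P for a fresh nullary atom P. Then N₂(A) → N₁(A) is
-- (((P → F) → F) → F) → ¬¬¬P ∨ F, and substituting F for P turns an
-- intuitionistic proof of it into one of ¬¬¬F ∨ F, because the premise
-- ((F → F) → F) → F is provable. By the disjunction property of IL (proved with
-- the Aczel slash) IL would prove ¬¬¬F, hence ¬F, or F; the former contradicts
-- the hypothesis, the latter is impossible since CL ⊢ ¬F and CL is sound for the
-- two-valued one-point model.
module Submission where

open import Defs
open import Data.Bool using (Bool; true; false; T; if_then_else_; _∧_; _∨_)
open import Data.Bool.Properties using (T-∧; T-∨; T?)
open import Data.Empty using (⊥; ⊥-elim)
open import Data.List using (List; []; _∷_; map)
open import Data.List.Membership.Propositional.Properties using (∈-map⁺)
import Data.List.Properties as List
open import Data.List.Relation.Unary.All as All using (All; []; _∷_)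
open import Data.List.Relation.Unary.All.Properties using (map⁺)
open import Data.List.Relation.Unary.Any using (here; there)
open import Data.Nat using (ℕ; zero; suc; _⊔_; _<_; _≟_)
open import Data.Nat.Properties using (<-irrefl; m⊔n<o⇒m<o; m⊔n<o⇒n<o; n<1+n)
open import Data.Product using (Σ; _×_; _,_; proj₁; proj₂)
open import Data.Sum as Sum using (_⊎_; inj₁; inj₂; [_,_])
open import Data.Unit using (⊤; tt)
open import Data.Vec using ([])
import Data.Vec.Properties as Vec
open import Function using (_∘_; id)
import Function.Bundles as Fun
open import Function.Bundles using (mk⇔; module Equivalence)
open import Relation.Nullary using (¬_; yes; no)
open import Relation.Nullary.Decidable using (decidable-stable)
open import Relation.Binary.PropositionalEquality
  using (_≡_; _≗_; refl; sym; trans; cong; cong₂; subst; subst₂)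

open Equivalence using (to; from)

private
  variable
    L : Logic
    Γ : List Fm
    ρ σ τ : ℕ → ℕ

lift-fusion : σ ∘ ρ ≗ τ → lift σ ∘ lift ρ ≗ lift τ
lift-fusion h zero = refl
lift-fusion h (suc k) = cong suc (h k)

lift-id : ρ ≗ id → lift ρ ≗ id
lift-id h zero = refl
lift-id h (suc k) = cong suc (h k)

ren-fusion : ∀ A → σ ∘ ρ ≗ τ → ren σ (ren ρ A) ≡ ren τ A
ren-fusion {σ} {ρ} (atom p n xs) h =
  cong (atom p n) (trans (sym (Vec.map-∘ σ ρ xs)) (Vec.map-cong h xs))
ren-fusion ⊥' h = refl
ren-fusion (A ∧' B) h = cong₂ _∧'_ (ren-fusion A h) (ren-fusion B h)
ren-fusion (A ∨' B) h = cong₂ _∨'_ (ren-fusion A h) (ren-fusion B h)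
ren-fusion (A ⇒ B) h = cong₂ _⇒_ (ren-fusion A h) (ren-fusion B h)
ren-fusion (∀' A) h = cong ∀' (ren-fusion A (lift-fusion h))
ren-fusion (∃' A) h = cong ∃' (ren-fusion A (lift-fusion h))

ren-id : ∀ A → ρ ≗ id → ren ρ A ≡ A
ren-id (atom p n xs) h = cong (atom p n) (trans (Vec.map-cong h xs) (Vec.map-id xs))
ren-id ⊥' h = refl
ren-id (A ∧' B) h = cong₂ _∧'_ (ren-id A h) (ren-id B h)
ren-id (A ∨' B) h = cong₂ _∨'_ (ren-id A h) (ren-id B h)
ren-id (A ⇒ B) h = cong₂ _⇒_ (ren-id A h) (ren-id B h)
ren-id (∀' A) h = cong ∀' (ren-id A (lift-id h))
ren-id (∃' A) h = cong ∃' (ren-id A (lift-id h))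

ren-shift : ∀ ρ B → ren (lift ρ) (shift B) ≡ shift (ren ρ B)
ren-shift ρ B = trans (ren-fusion B λ _ → refl) (sym (ren-fusion B λ _ → refl))

ren-inst : ∀ ρ x A → ren (lift ρ) A [ ρ x ] ≡ ren ρ (A [ x ])
ren-inst ρ x A = trans (ren-fusion A inst-lift) (sym (ren-fusion A λ _ → refl))
  where
  inst-lift : inst0 (ρ x) ∘ lift ρ ≗ ρ ∘ inst0 x
  inst-lift zero = refl
  inst-lift (suc k) = refl

inst-shift : ∀ x C → shift C [ x ] ≡ C
inst-shift x C = trans (ren-fusion C λ _ → refl) (ren-id C λ _ → refl)

map-shift-comm : {f g : Fm → Fm} → f ∘ shift ≗ shift ∘ g →
                 ∀ Γ → map f (map shift Γ) ≡ map shift (map g Γ)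
map-shift-comm h Γ = trans (sym (List.map-∘ Γ)) (trans (List.map-cong h Γ) (List.map-∘ Γ))

ren-⊢ : ∀ {A} ρ → L ⨾ Γ ⊢ A → L ⨾ map (ren ρ) Γ ⊢ ren ρ A
ren-⊢ ρ (hyp i) = hyp (∈-map⁺ (ren ρ) i)
ren-⊢ ρ (⊥E d) = ⊥E (ren-⊢ ρ d)
ren-⊢ ρ (raa d) = raa (ren-⊢ ρ d)
ren-⊢ ρ (∧I d e) = ∧I (ren-⊢ ρ d) (ren-⊢ ρ e)
ren-⊢ ρ (∧E₁ d) = ∧E₁ (ren-⊢ ρ d)
ren-⊢ ρ (∧E₂ d) = ∧E₂ (ren-⊢ ρ d)
ren-⊢ ρ (∨I₁ d) = ∨I₁ (ren-⊢ ρ d)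
ren-⊢ ρ (∨I₂ d) = ∨I₂ (ren-⊢ ρ d)
ren-⊢ ρ (∨E d e f) = ∨E (ren-⊢ ρ d) (ren-⊢ ρ e) (ren-⊢ ρ f)
ren-⊢ ρ (⇒I d) = ⇒I (ren-⊢ ρ d)
ren-⊢ ρ (⇒E d e) = ⇒E (ren-⊢ ρ d) (ren-⊢ ρ e)
ren-⊢ {L} {Γ} ρ (∀I d) =
  ∀I (subst (λ Δ → L ⨾ Δ ⊢ _) (map-shift-comm (ren-shift ρ) Γ) (ren-⊢ (lift ρ) d))
ren-⊢ {L} {Γ} ρ (∀E {A = A} x d) =
  subst (L ⨾ map (ren ρ) Γ ⊢_) (ren-inst ρ x A) (∀E (ρ x) (ren-⊢ ρ d))
ren-⊢ {L} {Γ} ρ (∃I {A = A} x d) =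
  ∃I (ρ x) (subst (L ⨾ map (ren ρ) Γ ⊢_) (sym (ren-inst ρ x A)) (ren-⊢ ρ d))
ren-⊢ {L} {Γ} ρ (∃E {A = A} {B = B} d e) =
  ∃E (ren-⊢ ρ d)
     (subst₂ (λ Δ X → L ⨾ (ren (lift ρ) A ∷ Δ) ⊢ X)
             (map-shift-comm (ren-shift ρ) Γ) (ren-shift ρ B) (ren-⊢ (lift ρ) e))

-- Substitution of a formula for a predicate symbol

infix 30 _⟪_≔_⟫

_⟪_≔_⟫ : Fm → ℕ → Fm → Fm
atom q n xs ⟪ p ≔ C ⟫ with q ≟ p
... | yes _ = C
... | no _ = atom q n xs
⊥' ⟪ p ≔ C ⟫ = ⊥'
(A ∧' B) ⟪ p ≔ C ⟫ = A ⟪ p ≔ C ⟫ ∧' B ⟪ p ≔ C ⟫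
(A ∨' B) ⟪ p ≔ C ⟫ = A ⟪ p ≔ C ⟫ ∨' B ⟪ p ≔ C ⟫
(A ⇒ B) ⟪ p ≔ C ⟫ = A ⟪ p ≔ C ⟫ ⇒ B ⟪ p ≔ C ⟫
∀' A ⟪ p ≔ C ⟫ = ∀' (A ⟪ p ≔ shift C ⟫)
∃' A ⟪ p ≔ C ⟫ = ∃' (A ⟪ p ≔ shift C ⟫)

atom-⟪≔⟫ : ∀ p C → atom p 0 [] ⟪ p ≔ C ⟫ ≡ C
atom-⟪≔⟫ p C with p ≟ p
... | yes _ = refl
... | no p≢p = ⊥-elim (p≢p refl)

maxPred : Fm → ℕ
maxPred (atom q n xs) = q
maxPred ⊥' = 0
maxPred (A ∧' B) = maxPred A ⊔ maxPred B
maxPred (A ∨' B) = maxPred A ⊔ maxPred B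
maxPred (A ⇒ B) = maxPred A ⊔ maxPred B
maxPred (∀' A) = maxPred A
maxPred (∃' A) = maxPred A

⟪≔⟫-fresh : ∀ A {p} C → maxPred A < p → A ⟪ p ≔ C ⟫ ≡ A
⟪≔⟫-fresh (atom q n xs) {p} C q<p with q ≟ p
... | yes refl = ⊥-elim (<-irrefl refl q<p)
... | no _ = refl
⟪≔⟫-fresh ⊥' C _ = refl
⟪≔⟫-fresh (A ∧' B) C h =
  cong₂ _∧'_ (⟪≔⟫-fresh A C (m⊔n<o⇒m<o _ _ h)) (⟪≔⟫-fresh B C (m⊔n<o⇒n<o _ _ h))
⟪≔⟫-fresh (A ∨' B) C h =
  cong₂ _∨'_ (⟪≔⟫-fresh A C (m⊔n<o⇒m<o _ _ h)) (⟪≔⟫-fresh B C (m⊔n<o⇒n<o _ _ h))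
⟪≔⟫-fresh (A ⇒ B) C h =
  cong₂ _⇒_ (⟪≔⟫-fresh A C (m⊔n<o⇒m<o _ _ h)) (⟪≔⟫-fresh B C (m⊔n<o⇒n<o _ _ h))
⟪≔⟫-fresh (∀' A) C h = cong ∀' (⟪≔⟫-fresh A (shift C) h)
⟪≔⟫-fresh (∃' A) C h = cong ∃' (⟪≔⟫-fresh A (shift C) h)

ren-⟪≔⟫ : ∀ ρ A p C → ren ρ (A ⟪ p ≔ C ⟫) ≡ ren ρ A ⟪ p ≔ ren ρ C ⟫
ren-⟪≔⟫ ρ (atom q n xs) p C with q ≟ p
... | yes _ = refl
... | no _ = refl
ren-⟪≔⟫ ρ ⊥' p C = refl
ren-⟪≔⟫ ρ (A ∧' B) p C = cong₂ _∧'_ (ren-⟪≔⟫ ρ A p C) (ren-⟪≔⟫ ρ B p C)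
ren-⟪≔⟫ ρ (A ∨' B) p C = cong₂ _∨'_ (ren-⟪≔⟫ ρ A p C) (ren-⟪≔⟫ ρ B p C)
ren-⟪≔⟫ ρ (A ⇒ B) p C = cong₂ _⇒_ (ren-⟪≔⟫ ρ A p C) (ren-⟪≔⟫ ρ B p C)
ren-⟪≔⟫ ρ (∀' A) p C =
  cong ∀' (trans (ren-⟪≔⟫ (lift ρ) A p (shift C)) (cong (ren (lift ρ) A ⟪ p ≔_⟫) (ren-shift ρ C)))
ren-⟪≔⟫ ρ (∃' A) p C =
  cong ∃' (trans (ren-⟪≔⟫ (lift ρ) A p (shift C)) (cong (ren (lift ρ) A ⟪ p ≔_⟫) (ren-shift ρ C)))

inst-⟪≔⟫ : ∀ A p C x → (A ⟪ p ≔ shift C ⟫) [ x ] ≡ (A [ x ]) ⟪ p ≔ C ⟫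
inst-⟪≔⟫ A p C x = trans (ren-⟪≔⟫ (inst0 x) A p (shift C)) (cong ((A [ x ]) ⟪ p ≔_⟫) (inst-shift x C))

⟪≔⟫-shift : ∀ p C → (_⟪ p ≔ shift C ⟫) ∘ shift ≗ shift ∘ (_⟪ p ≔ C ⟫)
⟪≔⟫-shift p C B = sym (ren-⟪≔⟫ suc B p C)

⟪≔⟫-⊢ : ∀ {A} p C → L ⨾ Γ ⊢ A → L ⨾ map (_⟪ p ≔ C ⟫) Γ ⊢ A ⟪ p ≔ C ⟫
⟪≔⟫-⊢ p C (hyp i) = hyp (∈-map⁺ (_⟪ p ≔ C ⟫) i)
⟪≔⟫-⊢ p C (⊥E d) = ⊥E (⟪≔⟫-⊢ p C d)
⟪≔⟫-⊢ p C (raa d) = raa (⟪≔⟫-⊢ p C d)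
⟪≔⟫-⊢ p C (∧I d e) = ∧I (⟪≔⟫-⊢ p C d) (⟪≔⟫-⊢ p C e)
⟪≔⟫-⊢ p C (∧E₁ d) = ∧E₁ (⟪≔⟫-⊢ p C d)
⟪≔⟫-⊢ p C (∧E₂ d) = ∧E₂ (⟪≔⟫-⊢ p C d)
⟪≔⟫-⊢ p C (∨I₁ d) = ∨I₁ (⟪≔⟫-⊢ p C d)
⟪≔⟫-⊢ p C (∨I₂ d) = ∨I₂ (⟪≔⟫-⊢ p C d)
⟪≔⟫-⊢ p C (∨E d e f) = ∨E (⟪≔⟫-⊢ p C d) (⟪≔⟫-⊢ p C e) (⟪≔⟫-⊢ p C f)
⟪≔⟫-⊢ p C (⇒I d) = ⇒I (⟪≔⟫-⊢ p C d)
⟪≔⟫-⊢ p C (⇒E d e) = ⇒E (⟪≔⟫-⊢ p C d) (⟪≔⟫-⊢ p C e)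
⟪≔⟫-⊢ {L} {Γ} p C (∀I d) =
  ∀I (subst (λ Δ → L ⨾ Δ ⊢ _) (map-shift-comm (⟪≔⟫-shift p C) Γ) (⟪≔⟫-⊢ p (shift C) d))
⟪≔⟫-⊢ {L} {Γ} p C (∀E {A = A} x d) =
  subst (L ⨾ map (_⟪ p ≔ C ⟫) Γ ⊢_) (inst-⟪≔⟫ A p C x) (∀E x (⟪≔⟫-⊢ p C d))
⟪≔⟫-⊢ {L} {Γ} p C (∃I {A = A} x d) =
  ∃I x (subst (L ⨾ map (_⟪ p ≔ C ⟫) Γ ⊢_) (sym (inst-⟪≔⟫ A p C x)) (⟪≔⟫-⊢ p C d))
⟪≔⟫-⊢ {L} {Γ} p C (∃E {A = A} {B = B} d e) =
  ∃E (⟪≔⟫-⊢ p C d)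
     (subst₂ (λ Δ X → L ⨾ (A ⟪ p ≔ shift C ⟫ ∷ Δ) ⊢ X)
             (map-shift-comm (⟪≔⟫-shift p C) Γ) (⟪≔⟫-shift p C B) (⟪≔⟫-⊢ p (shift C) e))

-- The disjunction property of IL

_∷ₑ_ : ℕ → (ℕ → ℕ) → ℕ → ℕ
(x ∷ₑ σ) zero = x
(x ∷ₑ σ) (suc n) = σ n

-- Aczel's slash, for closed instances ren σ A of A under the variable assignment σ.
mutual
  Slash⊢ : (ℕ → ℕ) → Fm → Set
  Slash⊢ σ A = (IL ⊢ ren σ A) × Slash σ A

  Slash : (ℕ → ℕ) → Fm → Set
  Slash σ (atom p n xs) = ⊤
  Slash σ ⊥' = ⊥
  Slash σ (A ∧' B) = Slash σ A × Slash σ B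
  Slash σ (A ∨' B) = Slash⊢ σ A ⊎ Slash⊢ σ B
  Slash σ (A ⇒ B) = Slash⊢ σ A → Slash σ B
  Slash σ (∀' A) = ∀ x → Slash (x ∷ₑ σ) A
  Slash σ (∃' A) = Σ ℕ λ x → Slash⊢ (x ∷ₑ σ) A

∷ₑ-lift : ∀ x → σ ∘ ρ ≗ τ → (x ∷ₑ σ) ∘ lift ρ ≗ x ∷ₑ τ
∷ₑ-lift x h zero = refl
∷ₑ-lift x h (suc k) = h k

mutual
  slash-ren : ∀ A → σ ∘ ρ ≗ τ → Slash σ (ren ρ A) Fun.⇔ Slash τ A
  slash-ren (atom p n xs) h = mk⇔ _ _
  slash-ren ⊥' h = mk⇔ id id
  slash-ren (A ∧' B) h =
    mk⇔ (λ (a , b) → to (slash-ren A h) a , to (slash-ren B h) b)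
        (λ (a , b) → from (slash-ren A h) a , from (slash-ren B h) b)
  slash-ren (A ∨' B) h =
    mk⇔ (Sum.map (to (slash⊢-ren A h)) (to (slash⊢-ren B h)))
        (Sum.map (from (slash⊢-ren A h)) (from (slash⊢-ren B h)))
  slash-ren (A ⇒ B) h =
    mk⇔ (λ f → to (slash-ren B h) ∘ f ∘ from (slash⊢-ren A h))
        (λ f → from (slash-ren B h) ∘ f ∘ to (slash⊢-ren A h))
  slash-ren (∀' A) h =
    mk⇔ (λ f x → to (slash-ren A (∷ₑ-lift x h)) (f x))
        (λ f x → from (slash-ren A (∷ₑ-lift x h)) (f x))
  slash-ren (∃' A) h =
    mk⇔ (λ (x , s) → x , to (slash⊢-ren A (∷ₑ-lift x h)) s)
        (λ (x , s) → x , from (slash⊢-ren A (∷ₑ-lift x h)) s)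

  slash⊢-ren : ∀ A → σ ∘ ρ ≗ τ → Slash⊢ σ (ren ρ A) Fun.⇔ Slash⊢ τ A
  slash⊢-ren A h =
    mk⇔ (λ (d , s) → subst (IL ⊢_) (ren-fusion A h) d , to (slash-ren A h) s)
        (λ (d , s) → subst (IL ⊢_) (sym (ren-fusion A h)) d , from (slash-ren A h) s)

slash⊢-shift : ∀ x → All (Slash⊢ σ) Γ → All (Slash⊢ (x ∷ₑ σ)) (map shift Γ)
slash⊢-shift x γ = map⁺ (All.map (λ {B} → from (slash⊢-ren B λ _ → refl)) γ)

∘-inst0 : ∀ σ x → σ ∘ inst0 x ≗ σ x ∷ₑ σ
∘-inst0 σ x zero = refl
∘-inst0 σ x (suc k) = refl

discharge : ∀ {Δ A} → IL ⨾ Δ ⊢ A → All (IL ⊢_) Δ → IL ⊢ A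
discharge d [] = d
discharge d (b ∷ bs) = ⇒E (discharge (⇒I d) bs) b

mutual
  slash⊢-sound : ∀ {A} → IL ⨾ Γ ⊢ A → ∀ σ → All (Slash⊢ σ) Γ → Slash⊢ σ A
  slash⊢-sound d σ γ = discharge (ren-⊢ σ d) (map⁺ (All.map proj₁ γ)) , slash-sound d σ γ

  slash-sound : ∀ {A} → IL ⨾ Γ ⊢ A → ∀ σ → All (Slash⊢ σ) Γ → Slash σ A
  slash-sound (hyp i) σ γ = proj₂ (All.lookup γ i)
  slash-sound (⊥E d) σ γ = ⊥-elim (slash-sound d σ γ)
  slash-sound (∧I d e) σ γ = slash-sound d σ γ , slash-sound e σ γ
  slash-sound (∧E₁ d) σ γ = proj₁ (slash-sound d σ γ)
  slash-sound (∧E₂ d) σ γ = proj₂ (slash-sound d σ γ)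
  slash-sound (∨I₁ d) σ γ = inj₁ (slash⊢-sound d σ γ)
  slash-sound (∨I₂ d) σ γ = inj₂ (slash⊢-sound d σ γ)
  slash-sound (∨E d e f) σ γ =
    [ (λ a → slash-sound e σ (a ∷ γ)) , (λ b → slash-sound f σ (b ∷ γ)) ] (slash-sound d σ γ)
  slash-sound (⇒I d) σ γ = λ a → slash-sound d σ (a ∷ γ)
  slash-sound (⇒E d e) σ γ = slash-sound d σ γ (slash⊢-sound e σ γ)
  slash-sound (∀I d) σ γ = λ x → slash-sound d (x ∷ₑ σ) (slash⊢-shift x γ)
  slash-sound (∀E {A = A} x d) σ γ =
    from (slash-ren A (∘-inst0 σ x)) (slash-sound d σ γ (σ x))
  slash-sound (∃I {A = A} x d) σ γ =
    σ x , to (slash⊢-ren A (∘-inst0 σ x)) (slash⊢-sound d σ γ)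
  slash-sound (∃E {B = B} d e) σ γ with slash-sound d σ γ
  ... | y , a = to (slash-ren B λ _ → refl) (slash-sound e (y ∷ₑ σ) (a ∷ slash⊢-shift y γ))

disjunction-property : ∀ {A B} → IL ⊢ (A ∨' B) → (IL ⊢ A) ⊎ (IL ⊢ B)
disjunction-property {A} {B} d with slash-sound d id []
... | inj₁ (a , _) = inj₁ (subst (IL ⊢_) (ren-id A λ _ → refl) a)
... | inj₂ (b , _) = inj₂ (subst (IL ⊢_) (ren-id B λ _ → refl) b)

-- Soundness for the one-point model in which every atom is true

⟦_⟧ : Fm → Bool
⟦ atom p n xs ⟧ = true
⟦ ⊥' ⟧ = false
⟦ A ∧' B ⟧ = ⟦ A ⟧ ∧ ⟦ B ⟧
⟦ A ∨' B ⟧ = ⟦ A ⟧ ∨ ⟦ B ⟧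
⟦ A ⇒ B ⟧ = if ⟦ A ⟧ then ⟦ B ⟧ else true
⟦ ∀' A ⟧ = ⟦ A ⟧
⟦ ∃' A ⟧ = ⟦ A ⟧

⟦⟧-ren : ∀ ρ A → ⟦ ren ρ A ⟧ ≡ ⟦ A ⟧
⟦⟧-ren ρ (atom p n xs) = refl
⟦⟧-ren ρ ⊥' = refl
⟦⟧-ren ρ (A ∧' B) = cong₂ _∧_ (⟦⟧-ren ρ A) (⟦⟧-ren ρ B)
⟦⟧-ren ρ (A ∨' B) = cong₂ _∨_ (⟦⟧-ren ρ A) (⟦⟧-ren ρ B)
⟦⟧-ren ρ (A ⇒ B) = cong₂ (λ a b → if a then b else true) (⟦⟧-ren ρ A) (⟦⟧-ren ρ B)
⟦⟧-ren ρ (∀' A) = ⟦⟧-ren (lift ρ) A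
⟦⟧-ren ρ (∃' A) = ⟦⟧-ren (lift ρ) A

T-if-intro : ∀ a {b} → (T a → T b) → T (if a then b else true)
T-if-intro true f = f tt
T-if-intro false f = tt

T-if-elim : ∀ {a b} → T (if a then b else true) → T a → T b
T-if-elim {true} t _ = t

true-shift : All (T ∘ ⟦_⟧) Γ → All (T ∘ ⟦_⟧) (map shift Γ)
true-shift γ = map⁺ (All.map (λ {B} → subst T (sym (⟦⟧-ren suc B))) γ)

⟦⟧-sound : ∀ {A} → L ⨾ Γ ⊢ A → All (T ∘ ⟦_⟧) Γ → T ⟦ A ⟧
⟦⟧-sound (hyp i) γ = All.lookup γ i
⟦⟧-sound (⊥E d) γ = ⊥-elim (⟦⟧-sound d γ)
⟦⟧-sound (raa {A = A} d) γ =
  decidable-stable (T? ⟦ A ⟧) λ ¬a → ⟦⟧-sound d (T-if-intro ⟦ A ⟧ ¬a ∷ γ)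
⟦⟧-sound (∧I d e) γ = from T-∧ (⟦⟧-sound d γ , ⟦⟧-sound e γ)
⟦⟧-sound (∧E₁ d) γ = proj₁ (to T-∧ (⟦⟧-sound d γ))
⟦⟧-sound (∧E₂ d) γ = proj₂ (to T-∧ (⟦⟧-sound d γ))
⟦⟧-sound (∨I₁ d) γ = from T-∨ (inj₁ (⟦⟧-sound d γ))
⟦⟧-sound (∨I₂ d) γ = from T-∨ (inj₂ (⟦⟧-sound d γ))
⟦⟧-sound (∨E d e f) γ =
  [ (λ a → ⟦⟧-sound e (a ∷ γ)) , (λ b → ⟦⟧-sound f (b ∷ γ)) ] (to T-∨ (⟦⟧-sound d γ))
⟦⟧-sound (⇒I {A = A} d) γ = T-if-intro ⟦ A ⟧ λ a → ⟦⟧-sound d (a ∷ γ)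
⟦⟧-sound (⇒E d e) γ = T-if-elim (⟦⟧-sound d γ) (⟦⟧-sound e γ)
⟦⟧-sound (∀I d) γ = ⟦⟧-sound d (true-shift γ)
⟦⟧-sound (∀E {A = A} x d) γ = subst T (sym (⟦⟧-ren (inst0 x) A)) (⟦⟧-sound d γ)
⟦⟧-sound (∃I {A = A} x d) γ = subst T (⟦⟧-ren (inst0 x) A) (⟦⟧-sound d γ)
⟦⟧-sound (∃E {B = B} d e) γ =
  subst T (⟦⟧-ren suc B) (⟦⟧-sound e (⟦⟧-sound d γ ∷ true-shift γ))

classically-refutable⇒unprovable : ∀ {F} → CL ⊢ ¬' F → ¬ (L ⊢ F)
classically-refutable⇒unprovable ⊢¬F ⊢F = T-if-elim (⟦⟧-sound ⊢¬F []) (⟦⟧-sound ⊢F [])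

¬¬¬⇒¬ : ∀ F → IL ⊢ (¬' (¬' (¬' F)) ⇒ ¬' F)
¬¬¬⇒¬ F = ⇒I (⇒I (⇒E (hyp (there (here refl))) (⇒I (⇒E (hyp (here refl)) (hyp (there (here refl)))))))

proposition1 : (F : Fm) → CL ⊢ ¬' F → ¬ (IL ⊢ ¬' F)
    → Σ Fm (λ A → ¬ (IL ⊢ (N₁ F A ⇔ N₂ F A)))
proposition1 F cl⊢¬F il⊬¬F = ¬' (atom p 0 []) , λ equiv → refute (instantiate (∧E₂ equiv))
  where
  p : ℕ
  p = suc (maxPred F)

  -- N₂ F (¬' (atom p 0 [])) ⇒ N₁ F (¬' (atom p 0 [])) is definitionally shape (atom p 0 []) F.
  shape : Fm → Fm → Fm
  shape X Y = (((X ⇒ Y) ⇒ Y) ⇒ Y) ⇒ (¬' (¬' (¬' X)) ∨' Y)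

  instantiate : IL ⊢ shape (atom p 0 []) F → IL ⊢ shape F F
  instantiate d = subst₂ (λ X Y → IL ⊢ shape X Y)
    (atom-⟪≔⟫ p F) (⟪≔⟫-fresh F F (n<1+n _)) (⟪≔⟫-⊢ p F d)

  premise : IL ⊢ (((F ⇒ F) ⇒ F) ⇒ F)
  premise = ⇒I (⇒E (hyp (here refl)) (⇒I (hyp (here refl))))

  refute : IL ⊢ shape F F → ⊥
  refute d with disjunction-property (⇒E d premise)
  ... | inj₁ ⊢¬¬¬F = il⊬¬F (⇒E (¬¬¬⇒¬ F) ⊢¬¬¬F)
  ... | inj₂ ⊢F = classically-refutable⇒unprovable cl⊢¬F ⊢F
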